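{- Let $G_1=(V_1,E_1)$ and $G_2=(V_2,E_2)$ be trees with $V_1\cap V_2=\{v\}$ and $E_1\cap E_2=\varnothing$, and let the edges of $E_1\cup E_2$ carry distinct ranks. Let $D_1$ and $D_2$ be the single-linkage dendrograms of $G_1$ and $G_2$. For $i=1,2$, let $e_i^\star$ be the minimum-rank edge of $G_i$ incident to $v$, and let $S_i=\mathrm{spine}_{D_i}(e_i^\star)$; if $G_i$ is the single vertex $v$, set $S_i=\varnothing$. Let $S=S_1\cup S_2$. Define a parent function $p$ on $E_1\cup E_2$ as follows (the SLD-Merge procedure, which merges the two sorted spines as lists): - For $e\in E_i\setminus S$, $p(e)$ is the parent of $e$ in $D_i$. - For $e\in S$, $p(e)$ is the element of $S$ of smallest rank greater than $r_e$. - The maximum-rank element of $S$ is the root. Then $p$ is exactly the parent function of the single-linkage dendrogram of $G_1\cup G_2=(V_1\cup V_2,E_1\cup E_2)$.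
   Context: For a tree whose edges have distinct ranks $r_e$ (the position of $e$ in the order of edges sorted by weight, with ties broken consistently), the single-linkage dendrogram (SLD) is defined by the following process. Start with every vertex as a singleton cluster and process the edges in increasing order of rank; processing $e=(u,v)$ merges the current clusters of $u$ and $v$. The SLD is the rooted binary tree whose leaves are the vertices and whose internal nodes are the edges. The children of node $e$ represent the two clusters merged when $e$ is processed: a leaf for a singleton cluster, and otherwise the edge whose processing created that cluster. The parent of an internal node $e$ is the edge whose processing next merges the cluster created by $e$; the last edge processed is the root. The dendrogram is represented by the parent of each internal node, with leaves dropped. $\mathrm{spine}_D(e)$ is the set of internal nodes on the path from $e$ to the root of $D$, including both $e$ and the root; ranks strictly increase along it. The ranks on $E_1$ and on $E_2$ are the restrictions of the given rank order on $E_1\cup E_2$. -}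

module Defs where

open import Data.Nat using (ℕ; _≤_; _<_; _≡ᵇ_; _≤ᵇ_; suc)
open import Data.Bool using (Bool; true; false; if_then_else_; _∨_)
open import Data.Maybe using (Maybe; just; nothing)
open import Data.Product using (Σ; _×_; _,_; proj₂)
open import Data.Sum using (_⊎_)
open import Data.List using (List; []; _∷_; map; length; foldl)
open import Data.List.Membership.Propositional using (_∈_)
open import Data.List.Relation.Unary.All using (All)
open import Data.List.Relation.Unary.Unique.Propositional using (Unique)
open import Relation.Binary.PropositionalEquality using (_≡_; _≢_)

-- An edge carries its rank (a natural number; ranks are distinct, so the
-- rank identifies the edge and internal dendrogram nodes are named by ranks)
-- and its two endpoints.
record Edge : Set where
  constructor edge
  field
    rk : ℕ
    u  : ℕ
    w  : ℕ
open Edge public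

Incident : Edge → ℕ → Set
Incident e x = (u e ≡ x) ⊎ (w e ≡ x)

data Walk (E : List Edge) : ℕ → ℕ → Set where
  stay : ∀ {x} → Walk E x x
  fwd  : ∀ {x y} (e : Edge) → e ∈ E → u e ≡ x → Walk E (w e) y → Walk E x y
  bwd  : ∀ {x y} (e : Edge) → e ∈ E → w e ≡ x → Walk E (u e) y → Walk E x y

record IsTree (V : List ℕ) (E : List Edge) : Set where
  field
    verts-unique : Unique V
    ends-in-V    : All (λ e → (u e ∈ V) × (w e ∈ V)) E
    no-loops     : All (λ e → u e ≢ w e) E
    connected    : ∀ {x y} → x ∈ V → y ∈ V → Walk E x y
    edge-count   : length V ≡ suc (length E)

insertE : Edge → List Edge → List Edge
insertE e [] = e ∷ []
insertE e (f ∷ fs) = if rk e ≤ᵇ rk f then e ∷ f ∷ fs else f ∷ insertE e fs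

sortE : List Edge → List Edge
sortE [] = []
sortE (e ∷ es) = insertE e (sortE es)

-- Labels L x = the edge (rank) whose processing created the current cluster
-- of vertex x, or nothing if x is still a singleton.
Labels : Set
Labels = ℕ → Maybe ℕ

-- Parent map on internal nodes (ranks); nothing = no parent (yet) / root.
Parents : Set
Parents = ℕ → Maybe ℕ

eqM : Maybe ℕ → Maybe ℕ → Bool
eqM (just a) (just b) = a ≡ᵇ b
eqM _ _ = false

inCluster : Labels → ℕ → ℕ → Bool
inCluster L x y = (y ≡ᵇ x) ∨ eqM (L x) (L y)

setParent : ℕ → Maybe ℕ → Parents → Parents
setParent r nothing  P = P
setParent r (just c) P = λ z → if z ≡ᵇ c then just r else P z

step : Labels × Parents → Edge → Labels × Parents
step (L , P) e =
  (λ y → if inCluster L (u e) y ∨ inCluster L (w e) y then just (rk e) else L y)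
  , setParent (rk e) (L (u e)) (setParent (rk e) (L (w e)) P)

initial : Labels × Parents
initial = (λ _ → nothing) , (λ _ → nothing)

-- parent function of the single-linkage dendrogram of the graph with edges E
-- (meaningful on ranks of edges of E; the root has parent nothing)
SLD : List Edge → Parents
SLD E = proj₂ (foldl step initial (sortE E))

-- Anc D e f : f lies on spine_D(e), i.e. on the path from e to the root
data Anc (D : Parents) : ℕ → ℕ → Set where
  here  : ∀ {e} → Anc D e e
  there : ∀ {e g f} → D e ≡ just g → Anc D g f → Anc D e f

IsMinIncident : List Edge → ℕ → Edge → Set
IsMinIncident E v e =
  (e ∈ E) × Incident e v × (∀ f → f ∈ E → Incident f v → rk e ≤ rk f)

-- x ∈ S_i = spine_{D_i}(e_i*) (empty if E_i has no edge at v)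
InSpine : List Edge → ℕ → ℕ → Set
InSpine E v x = Σ Edge (λ e → IsMinIncident E v e × Anc (SLD E) (rk e) x)

InS : List Edge → List Edge → ℕ → ℕ → Set
InS E₁ E₂ v x = InSpine E₁ v x ⊎ InSpine E₂ v x

{-# OPTIONS --safe #-}
module Submission where

-- Run the merging processes on E₁, on E₂ and on E₁ ++ E₂ in lockstep: sorting E₁ ++ E₂ by rank
-- interleaves the sorted E₁ and E₂. Since the trees share only v and their ranks are distinct, on Vᵢ
-- the clusters of the combined run are those of the run on Eᵢ, except that the cluster of v of the
-- latter is absorbed into the combined cluster of v. Hence a node whose cluster avoids v creates the
-- same cluster in both runs and gets the same parent. The nodes whose clusters contain v form the
-- spines, and in the combined run they are the nodes of S₁ and S₂ in rank order, each the parent of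
-- the previous one.

open import Defs
open import Data.Nat using (ℕ; _≤_; _<_; _>_; suc; _≤ᵇ_; _≡ᵇ_; z≤n)
open import Data.Nat.Properties
  using (_≟_; ≤-refl; ≤-trans; ≤-antisym; <-irrefl; <-asym; <⇒≤; <⇒≱; <-≤-trans; n≤1+n; ≤∧≢⇒<; ≰⇒>;
         ≤ᵇ-reflects-≤)
open import Data.Bool using (true; false; if_then_else_; _∨_)
open import Data.Maybe using (just; nothing; maybe′)
open import Data.Maybe.Properties using (just-injective)
import Data.Maybe.Properties as Maybe
open import Data.Product using (Σ; _×_; _,_; proj₁; proj₂)
open import Data.Sum using (_⊎_; inj₁; inj₂)
import Data.Sum as Sum
open import Data.Sum.Properties using (inj₁-injective; inj₂-injective; ≡-dec)
open import Data.List using (List; []; _∷_; map; _++_; foldl; head; last)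
open import Data.List.Properties using (map-++)
open import Data.List.Membership.Propositional using (_∈_; _∉_)
open import Data.List.Membership.Propositional.Properties using (∈-map⁺; ∈-++⁺ˡ; ∈-++⁺ʳ; ∈-++⁻)
open import Data.List.Relation.Unary.Any using (here; there)
open import Data.List.Relation.Unary.All using (All; []; _∷_)
import Data.List.Relation.Unary.All as All
import Data.List.Relation.Unary.All.Properties as Allₚ
open import Data.List.Relation.Unary.AllPairs using (AllPairs; []; _∷_)
import Data.List.Relation.Unary.AllPairs as AllPairs
open import Data.List.Relation.Unary.Linked using (Linked; []; [-]; _∷_)
import Data.List.Relation.Unary.Linked as Linked
open import Data.List.Relation.Unary.Unique.Propositional using (Unique)
import Data.List.Relation.Binary.Pointwise as Pointwise
open import Data.List.Relation.Binary.Permutation.Propositional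
  using (_↭_; ↭-refl; ↭-sym; ↭-trans; prep; swap)
open import Data.List.Relation.Binary.Permutation.Propositional.Properties using (∈-resp-↭; All-resp-↭)
open import Data.List.Relation.Ternary.Interleaving.Propositional as Interleaving
  using (Interleaving; []; consˡ; consʳ; toPermutation)
open import Function using (_∘_; _⇔_; mk⇔; Equivalence)
open Equivalence using (to; from)
open import Relation.Binary.PropositionalEquality using (_≡_; _≢_; refl; sym; trans; cong; subst)
open import Relation.Nullary using (¬_; Dec; yes; no; _because_; proof; contradiction)
open import Relation.Nullary.Reflects using (Reflects; ofʸ; ofⁿ; det)

State : Set
State = Labels × Parents

labels : State → Labels
labels = proj₁

parents : State → Parents
parents = proj₂

private variable
  m n v : ℕ
  e f : Edge
  l A B E₁ E₂ : List Edge
  V₁ V₂ Tc T₁ T₂ : List ℕ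
  S S₁ S₂ : State

head-∈ : ∀ {X : Set} {xs : List X} {x} → head xs ≡ just x → x ∈ xs
head-∈ {xs = _ ∷ _} refl = here refl

last-∈ : ∀ {X : Set} (x : X) xs → Σ X λ y → last (x ∷ xs) ≡ just y × y ∈ x ∷ xs
last-∈ x []        = x , refl , here refl
last-∈ x (x′ ∷ xs) with last-∈ x′ xs
... | y , last≡y , y∈xs = y , last≡y , there y∈xs

unique-++-apart : ∀ {X : Set} (xs : List X) {ys x} → Unique (xs ++ ys) → x ∈ xs → x ∉ ys
unique-++-apart (_ ∷ xs) (x∉ ∷ _)   (here refl)  x∈ys = All.lookup x∉ (∈-++⁺ʳ xs x∈ys) refl
unique-++-apart (_ ∷ xs) (_ ∷ uniq) (there x∈xs)      = unique-++-apart xs uniq x∈xs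

interleaving-head : ∀ {X : Set} {a b l : List X} → Interleaving a b l → head l ≡ head a ⊎ head l ≡ head b
interleaving-head []        = inj₁ refl
interleaving-head (consˡ _) = inj₁ refl
interleaving-head (consʳ _) = inj₂ refl

∈-interleavingˡ : ∀ {X : Set} {a b l : List X} {x} → Interleaving a b l → x ∈ a → x ∈ l
∈-interleavingˡ il x∈a = ∈-resp-↭ (↭-sym (toPermutation il)) (∈-++⁺ˡ x∈a)

∈-interleaving⁻ : ∀ {X : Set} {a b l : List X} {x} → Interleaving a b l → x ∈ l → x ∈ a ⊎ x ∈ b
∈-interleaving⁻ {a = a} il x∈l = ∈-++⁻ a (∈-resp-↭ (toPermutation il) x∈l)

pushIf : ∀ {P X : Set} → Dec P → X → List X → List X
pushIf (yes _) r xs = r ∷ xs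
pushIf (no _)  _ xs = xs

∈-pushIf : ∀ {P X : Set} (p? : Dec P) {r : X} {xs x} → x ∈ xs → x ∈ pushIf p? r xs
∈-pushIf (yes _) = there
∈-pushIf (no _)  = λ x∈xs → x∈xs

interleaving-push : ∀ {P Q X : Set} {r : X} {a b l} (p? : Dec P) (q? : Dec Q) → P ⇔ Q →
                    Interleaving a b l → Interleaving (pushIf q? r a) b (pushIf p? r l)
interleaving-push (yes _) (yes _) _   il = consˡ il
interleaving-push (no _)  (no _)  _   il = il
interleaving-push (yes p) (no ¬q) p⇔q _  = contradiction (to p⇔q p) ¬q
interleaving-push (no ¬p) (yes q) p⇔q _  = contradiction (from p⇔q q) ¬p

-- Sorting by rank

data Ascending : ℕ → List Edge → Set where
  []  : Ascending n []
  _∷_ : n ≤ rk e → Ascending (suc (rk e)) l → Ascending n (e ∷ l)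

ascending-weaken : m ≤ n → Ascending n l → Ascending m l
ascending-weaken m≤n []         = []
ascending-weaken m≤n (n≤e ∷ as) = ≤-trans m≤n n≤e ∷ as

ascending-≤ : Ascending n l → f ∈ l → n ≤ rk f
ascending-≤ (n≤f ∷ as) (here refl) = n≤f
ascending-≤ (n≤e ∷ as) (there f∈l) = ≤-trans n≤e (<⇒≤ (ascending-≤ as f∈l))

insertE-↭ : ∀ e l → insertE e l ↭ e ∷ l
insertE-↭ e []      = ↭-refl
insertE-↭ e (f ∷ l) with rk e ≤ᵇ rk f
... | true  = ↭-refl
... | false = ↭-trans (prep f (insertE-↭ e l)) (swap f e ↭-refl)

sortE-↭ : ∀ l → sortE l ↭ l
sortE-↭ []      = ↭-refl
sortE-↭ (e ∷ l) = ↭-trans (insertE-↭ e (sortE l)) (prep e (sortE-↭ l))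

insertE-ascending : ∀ {n e l} → Ascending n l → n ≤ rk e → All (λ f → rk e ≢ rk f) l →
                    Ascending n (insertE e l)
insertE-ascending [] n≤e _ = n≤e ∷ []
insertE-ascending {e = e} {l = f ∷ _} (n≤f ∷ as) n≤e (e≢f ∷ distinct)
  with rk e ≤ᵇ rk f | ≤ᵇ-reflects-≤ (rk e) (rk f)
... | true  | ofʸ e≤f = n≤e ∷ (≤∧≢⇒< e≤f e≢f ∷ as)
... | false | ofⁿ e≰f = n≤f ∷ insertE-ascending as (≰⇒> e≰f) distinct

sortE-ascending : ∀ l → Unique (map rk l) → Ascending 0 (sortE l)
sortE-ascending []      _                 = []
sortE-ascending (e ∷ l) (distinct ∷ uniq) =
  insertE-ascending (sortE-ascending l uniq) z≤n (All-resp-↭ (↭-sym (sortE-↭ l)) (Allₚ.map⁻ distinct))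

insertE-before : ∀ {n e l} → rk e ≤ n → Ascending n l → insertE e l ≡ e ∷ l
insertE-before {l = []}        _   _         = refl
insertE-before {e = e} {f ∷ _} e≤n (n≤f ∷ _) with rk e ≤ᵇ rk f | ≤ᵇ-reflects-≤ (rk e) (rk f)
... | true  | _        = refl
... | false | ofⁿ e≰f = contradiction (≤-trans e≤n n≤f) e≰f

interleaving-ascendingˡ : ∀ {n l a b} → Interleaving a b l → Ascending n l → Ascending n a
interleaving-ascendingˡ []         []         = []
interleaving-ascendingˡ (consˡ il) (n≤e ∷ as) = n≤e ∷ interleaving-ascendingˡ il as
interleaving-ascendingˡ (consʳ il) (n≤e ∷ as) =
  ascending-weaken (≤-trans n≤e (n≤1+n _)) (interleaving-ascendingˡ il as)

interleaving-ascendingʳ : ∀ {n l a b} → Interleaving a b l → Ascending n l → Ascending n b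
interleaving-ascendingʳ il = interleaving-ascendingˡ (Interleaving.swap il)

insertE-interleaving : ∀ {n e l a b} → Ascending n l → Interleaving a b l →
                       Interleaving (insertE e a) b (insertE e l)
insertE-interleaving _ [] = consˡ []
insertE-interleaving {e = e} {l = f ∷ _} (_ ∷ as) (consˡ il) with rk e ≤ᵇ rk f
... | true  = consˡ (consˡ il)
... | false = consˡ (insertE-interleaving as il)
insertE-interleaving {e = e} {l = f ∷ _} (_ ∷ as) (consʳ il)
  with rk e ≤ᵇ rk f | ≤ᵇ-reflects-≤ (rk e) (rk f)
... | true  | ofʸ e≤f = subst (λ a → Interleaving a _ _)
                               (sym (insertE-before (≤-trans e≤f (n≤1+n _)) (interleaving-ascendingˡ il as)))
                               (consˡ (consʳ il))
... | false | _        = consʳ (insertE-interleaving as il)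

sortE-++-interleaving : ∀ E₁ E₂ → Unique (map rk (E₁ ++ E₂)) →
                        Interleaving (sortE E₁) (sortE E₂) (sortE (E₁ ++ E₂))
sortE-++-interleaving []       E₂ _          = Interleaving.right (Pointwise.refl refl)
sortE-++-interleaving (e ∷ E₁) E₂ (_ ∷ uniq) =
  insertE-interleaving (sortE-ascending (E₁ ++ E₂) uniq) (sortE-++-interleaving E₁ E₂ uniq)

-- Clusters and a single merging step

-- Opaque, so that unification can recover L and x from cluster L x.
opaque
  cluster : Labels → ℕ → ℕ ⊎ ℕ
  cluster L x = maybe′ inj₂ (inj₁ x) (L x)

opaque
  unfolding cluster

  cluster-≡ : ∀ {L L′ : Labels} {x} → L x ≡ L′ x → cluster L x ≡ cluster L′ x
  cluster-≡ {x = x} = cong (maybe′ inj₂ (inj₁ x))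

  label⇒cluster : ∀ {L : Labels} {x k} → L x ≡ just k → cluster L x ≡ inj₂ k
  label⇒cluster {x = x} = cong (maybe′ inj₂ (inj₁ x))

  unlabelled⇒cluster : ∀ {L : Labels} {x} → L x ≡ nothing → cluster L x ≡ inj₁ x
  unlabelled⇒cluster {x = x} = cong (maybe′ inj₂ (inj₁ x))

  cluster-label : ∀ {L x k} → cluster L x ≡ inj₂ k → L x ≡ just k
  cluster-label {L} {x} eq with L x
  ... | just _ = cong just (inj₂-injective eq)

  cluster-singleton : ∀ {L x y} → cluster L x ≡ inj₁ y → x ≡ y
  cluster-singleton {L} {x} eq with L x
  ... | nothing = inj₁-injective eq

  cluster-injective : ∀ {L L′ x} → cluster L x ≡ cluster L′ x → L x ≡ L′ x
  cluster-injective {L} {L′} {x} eq with L x | L′ x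
  ... | nothing | nothing = refl
  ... | just _  | just _  = cong just (inj₂-injective eq)

  cluster-reflects : ∀ L x y → Reflects (cluster L x ≡ cluster L y) (inCluster L x y)
  cluster-reflects L x y with y ≡ᵇ x | proof (y ≟ x)
  ... | true  | ofʸ refl = ofʸ refl
  ... | false | ofⁿ y≢x with L x | L y
  ...   | nothing | nothing = ofⁿ (y≢x ∘ sym ∘ inj₁-injective)
  ...   | nothing | just _  = ofⁿ λ ()
  ...   | just _  | nothing = ofⁿ λ ()
  ...   | just a  | just b with a ≡ᵇ b | proof (a ≟ b)
  ...     | true  | ofʸ refl = ofʸ refl
  ...     | false | ofⁿ a≢b = ofⁿ (a≢b ∘ inj₂-injective)

data Merged (L : Labels) (e : Edge) (y : ℕ) : Set where
  viaᵘ : cluster L (u e) ≡ cluster L y → Merged L e y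
  viaʷ : cluster L (w e) ≡ cluster L y → Merged L e y

merged-reflects : ∀ L e y → Reflects (Merged L e y) (inCluster L (u e) y ∨ inCluster L (w e) y)
merged-reflects L e y
  with inCluster L (u e) y | cluster-reflects L (u e) y | inCluster L (w e) y | cluster-reflects L (w e) y
... | true  | ofʸ sameᵘ | _     | _         = ofʸ (viaᵘ sameᵘ)
... | false | ofⁿ _     | true  | ofʸ sameʷ = ofʸ (viaʷ sameʷ)
... | false | ofⁿ diffᵘ | false | ofⁿ diffʷ = ofⁿ λ { (viaᵘ sameᵘ) → diffᵘ sameᵘ ; (viaʷ sameʷ) → diffʷ sameʷ }

merged? : ∀ L e y → Dec (Merged L e y)
merged? L e y = _ because merged-reflects L e y

merged-resp : ∀ {L e y y′} → cluster L y ≡ cluster L y′ → Merged L e y → Merged L e y′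
merged-resp eq (viaᵘ m) = viaᵘ (trans m eq)
merged-resp eq (viaʷ m) = viaʷ (trans m eq)

merged-label : ∀ {L e y k} → Merged L e y → L y ≡ just k → L (u e) ≡ just k ⊎ L (w e) ≡ just k
merged-label (viaᵘ m) Ly≡k = inj₁ (cluster-label (trans m (label⇒cluster Ly≡k)))
merged-label (viaʷ m) Ly≡k = inj₂ (cluster-label (trans m (label⇒cluster Ly≡k)))

incident-merged : ∀ {L e y} → Incident e y → Merged L e y
incident-merged (inj₁ refl) = viaᵘ refl
incident-merged (inj₂ refl) = viaʷ refl

merged-singleton-incident : ∀ {L e y} → L y ≡ nothing → Merged L e y → Incident e y
merged-singleton-incident Ly≡∅ (viaᵘ m) = inj₁ (cluster-singleton (trans m (unlabelled⇒cluster Ly≡∅)))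
merged-singleton-incident Ly≡∅ (viaʷ m) = inj₂ (cluster-singleton (trans m (unlabelled⇒cluster Ly≡∅)))

stepLabels : Labels → Edge → Labels
stepLabels L e y = if inCluster L (u e) y ∨ inCluster L (w e) y then just (rk e) else L y

stepParents : Labels → Parents → Edge → Parents
stepParents L P e = setParent (rk e) (L (u e)) (setParent (rk e) (L (w e)) P)

step-label-merged : ∀ {L e y} → Merged L e y → stepLabels L e y ≡ just (rk e)
step-label-merged {L} {e} {y} m = cong (if_then _ else L y) (det (merged-reflects L e y) (ofʸ m))

step-label-unmerged : ∀ {L e y} → ¬ Merged L e y → stepLabels L e y ≡ L y
step-label-unmerged {L} {e} {y} ¬m = cong (if_then just (rk e) else _) (det (merged-reflects L e y) (ofⁿ ¬m))

step-cluster-merged : ∀ {L e y} → Merged L e y → cluster (stepLabels L e) y ≡ inj₂ (rk e)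
step-cluster-merged m = label⇒cluster (step-label-merged m)

step-cluster-unmerged : ∀ {L e y} → ¬ Merged L e y → cluster (stepLabels L e) y ≡ cluster L y
step-cluster-unmerged ¬m = cluster-≡ (step-label-unmerged ¬m)

step-cluster-resp : ∀ {L e y y′} → cluster L y ≡ cluster L y′ →
                    cluster (stepLabels L e) y ≡ cluster (stepLabels L e) y′
step-cluster-resp {L} {e} {y} eq with merged? L e y
... | yes m = trans (step-cluster-merged m) (sym (step-cluster-merged (merged-resp eq m)))
... | no ¬m = trans (step-cluster-unmerged ¬m)
                    (trans eq (sym (step-cluster-unmerged (¬m ∘ merged-resp (sym eq)))))

step-same-cluster : ∀ {L e x y} → (∀ z → cluster L z ≢ inj₂ (rk e)) →
                    cluster (stepLabels L e) x ≡ cluster (stepLabels L e) y →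
                    cluster L x ≡ cluster L y ⊎ Merged L e x × Merged L e y
step-same-cluster {L} {e} {x} {y} fresh eq with merged? L e x | merged? L e y
... | yes mx | yes my = inj₂ (mx , my)
... | no ¬mx | no ¬my = inj₁ (trans (sym (step-cluster-unmerged ¬mx)) (trans eq (step-cluster-unmerged ¬my)))
... | yes mx | no ¬my =
  contradiction (trans (sym eq) (step-cluster-merged mx)) (fresh y ∘ trans (sym (step-cluster-unmerged ¬my)))
... | no ¬mx | yes my =
  contradiction (trans eq (step-cluster-merged my)) (fresh x ∘ trans (sym (step-cluster-unmerged ¬mx)))

setParent-hit : ∀ r {m} P {z} → m ≡ just z → setParent r m P z ≡ just r
setParent-hit r P {z} refl = cong (if_then just r else P z) (det (proof (z ≟ z)) (ofʸ refl))

setParent-miss : ∀ r {m} P {z} → m ≢ just z → setParent r m P z ≡ P z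
setParent-miss r {nothing} P _       = refl
setParent-miss r {just c}  P {z} m≢z =
  cong (if_then just r else P z) (det (proof (z ≟ c)) (ofⁿ (m≢z ∘ cong just ∘ sym)))

step-parent-hit : ∀ L P e {z} → L (u e) ≡ just z ⊎ L (w e) ≡ just z → stepParents L P e z ≡ just (rk e)
step-parent-hit L P e (inj₁ hitᵘ) = setParent-hit (rk e) _ hitᵘ
step-parent-hit L P e {z} (inj₂ hitʷ) with Maybe.≡-dec _≟_ (L (u e)) (just z)
... | yes hitᵘ  = setParent-hit (rk e) _ hitᵘ
... | no  missᵘ = trans (setParent-miss (rk e) _ missᵘ) (setParent-hit (rk e) P hitʷ)

step-parent-miss : ∀ L P e {z} → L (u e) ≢ just z → L (w e) ≢ just z → stepParents L P e z ≡ P z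
step-parent-miss L P e missᵘ missʷ = trans (setParent-miss (rk e) _ missᵘ) (setParent-miss (rk e) P missʷ)

step-parent-unlabelled : ∀ L P e {z} → (∀ y → L y ≢ just z) → stepParents L P e z ≡ P z
step-parent-unlabelled L P e unlabelled = step-parent-miss L P e (unlabelled _) (unlabelled _)

step-parent-cong : ∀ L P L′ P′ e {z} →
                   (L (u e) ≡ just z ⇔ L′ (u e) ≡ just z) → (L (w e) ≡ just z ⇔ L′ (w e) ≡ just z) →
                   P z ≡ P′ z → stepParents L P e z ≡ stepParents L′ P′ e z
step-parent-cong L P L′ P′ e {z} ⇔ᵘ ⇔ʷ Pz≡P′z
  with Maybe.≡-dec _≟_ (L (u e)) (just z) | Maybe.≡-dec _≟_ (L (w e)) (just z)
... | yes hitᵘ | _ =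
  trans (step-parent-hit L P e (inj₁ hitᵘ)) (sym (step-parent-hit L′ P′ e (inj₁ (to ⇔ᵘ hitᵘ))))
... | no _ | yes hitʷ =
  trans (step-parent-hit L P e (inj₂ hitʷ)) (sym (step-parent-hit L′ P′ e (inj₂ (to ⇔ʷ hitʷ))))
... | no missᵘ | no missʷ =
  trans (step-parent-miss L P e missᵘ missʷ)
        (trans Pz≡P′z (sym (step-parent-miss L′ P′ e (missᵘ ∘ from ⇔ᵘ) (missʷ ∘ from ⇔ʷ))))

-- The invariant of one run

-- A run is followed together with the spine of v: the nodes created by merges of the cluster of v,
-- newest first.
spineStep : ℕ → State → Edge → List ℕ → List ℕ
spineStep v S e = pushIf (merged? (labels S) e v) (rk e)

Chain : Parents → List ℕ → Set
Chain P = Linked (λ newer older → P older ≡ just newer)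

record RunInv (v n : ℕ) (S : State) (T : List ℕ) : Set where
  field
    labels-below  : ∀ {y k} → labels S y ≡ just k → k < n
    parents-fresh : ∀ {z} → n ≤ z → parents S z ≡ nothing
    labels-roots  : ∀ {y k} → labels S y ≡ just k → parents S k ≡ nothing
    v-label       : labels S v ≡ head T
    chain         : Chain (parents S) T
    descending    : AllPairs _>_ T
    spine-below   : All (_< n) T

runInv-initial : ∀ v → RunInv v 0 initial []
runInv-initial v = record
  { labels-below = λ () ; parents-fresh = λ _ → refl ; labels-roots = λ ()
  ; v-label = refl ; chain = [] ; descending = [] ; spine-below = [] }

runInv-weaken : ∀ {v m n S T} → m ≤ n → RunInv v m S T → RunInv v n S T
runInv-weaken m≤n I = record
  { labels-below  = λ eq → <-≤-trans (labels-below eq) m≤n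
  ; parents-fresh = λ n≤z → parents-fresh (≤-trans m≤n n≤z)
  ; labels-roots  = labels-roots
  ; v-label       = v-label
  ; chain         = chain
  ; descending    = descending
  ; spine-below   = All.map (λ t<m → <-≤-trans t<m m≤n) spine-below }
  where open RunInv I

cluster-fresh : ∀ {v n S T} → RunInv v n S T → ∀ {y k} → n ≤ k → cluster (labels S) y ≢ inj₂ k
cluster-fresh I n≤k eq = <-irrefl refl (<-≤-trans (RunInv.labels-below I (cluster-label eq)) n≤k)

v-label-∈ : ∀ {v n S T z} → RunInv v n S T → labels S v ≡ just z → z ∈ T
v-label-∈ I Lv≡z = head-∈ (trans (sym (RunInv.v-label I)) Lv≡z)

chain-push : ∀ {P r T} → Chain P T → (∀ {t} → head T ≡ just t → P t ≡ just r) → Chain P (r ∷ T)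
chain-push {T = []}    _     _    = [-]
chain-push {T = _ ∷ _} chain link = link refl ∷ chain

module _ {v n S T} (I : RunInv v n S T) (e : Edge) (n≤e : n ≤ rk e) where
  open RunInv I
  private
    L = labels S
    P = parents S
    r = rk e

    n≤1+r : n ≤ suc r
    n≤1+r = ≤-trans n≤e (n≤1+n r)

    unlabelled-above : ∀ {z} → n ≤ z → ∀ y → L y ≢ just z
    unlabelled-above n≤z y eq = <-irrefl refl (<-≤-trans (labels-below eq) n≤z)

    step-parent-above : ∀ {z} → n ≤ z → stepParents L P e z ≡ nothing
    step-parent-above n≤z = trans (step-parent-unlabelled L P e (unlabelled-above n≤z)) (parents-fresh n≤z)

    step-parent-stable : ∀ {z g} → P z ≡ just g → stepParents L P e z ≡ P z
    step-parent-stable {z} Pz≡g = step-parent-unlabelled L P e unlabelled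
      where unlabelled : ∀ y → L y ≢ just z
            unlabelled y Ly≡z with trans (sym Pz≡g) (labels-roots Ly≡z)
            ... | ()

    step-labels-below : ∀ {y k} → stepLabels L e y ≡ just k → k < suc r
    step-labels-below {y} eq with merged? L e y
    ... | yes m = subst (_< suc r) (just-injective (trans (sym (step-label-merged m)) eq)) ≤-refl
    ... | no ¬m = <-≤-trans (labels-below (trans (sym (step-label-unmerged ¬m)) eq)) n≤1+r

    step-labels-roots : ∀ {y k} → stepLabels L e y ≡ just k → stepParents L P e k ≡ nothing
    step-labels-roots {y} eq with merged? L e y
    ... | yes m = subst (λ k → stepParents L P e k ≡ nothing)
                        (just-injective (trans (sym (step-label-merged m)) eq)) (step-parent-above n≤e)
    ... | no ¬m = trans (step-parent-miss L P e (unmerged viaᵘ) (unmerged viaʷ)) (labels-roots Ly≡k)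
      where
        Ly≡k = trans (sym (step-label-unmerged ¬m)) eq
        unmerged : ∀ {x} → (cluster L x ≡ cluster L y → Merged L e y) → L x ≢ just _
        unmerged via Lx≡k = ¬m (via (trans (label⇒cluster Lx≡k) (sym (label⇒cluster Ly≡k))))

    spine-below-weaken : ∀ {m} → n ≤ m → All (_< m) T
    spine-below-weaken n≤m = All.map (λ t<n → <-≤-trans t<n n≤m) spine-below

    stable-chain : Chain (stepParents L P e) T
    stable-chain = Linked.map (λ Pc≡p → trans (step-parent-stable Pc≡p) Pc≡p) chain

    step-chain : Chain (parents (step S e)) (spineStep v S e T)
    step-chain with merged? L e v
    ... | no _  = stable-chain
    ... | yes m = chain-push stable-chain
                             (λ head≡t → step-parent-hit L P e (merged-label m (trans v-label head≡t)))

    step-v-label : labels (step S e) v ≡ head (spineStep v S e T)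
    step-v-label with merged? L e v
    ... | yes m = step-label-merged m
    ... | no ¬m = trans (step-label-unmerged ¬m) v-label

    step-descending : AllPairs _>_ (spineStep v S e T)
    step-descending with merged? L e v
    ... | yes _ = spine-below-weaken n≤e ∷ descending
    ... | no _  = descending

    step-spine-below : All (_< suc r) (spineStep v S e T)
    step-spine-below with merged? L e v
    ... | yes _ = ≤-refl ∷ spine-below-weaken n≤1+r
    ... | no _  = spine-below-weaken n≤1+r

  runInv-step : RunInv v (suc r) (step S e) (spineStep v S e T)
  runInv-step = record
    { labels-below  = step-labels-below
    ; parents-fresh = λ 1+r≤z → step-parent-above (≤-trans n≤1+r 1+r≤z)
    ; labels-roots  = step-labels-roots
    ; v-label       = step-v-label
    ; chain         = step-chain
    ; descending    = step-descending
    ; spine-below   = step-spine-below }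

-- The spine of v in the dendrogram

record SpineStart (v : ℕ) (E : List Edge) (T : List ℕ) (A : List Edge) : Set where
  field
    unstarted : T ≡ [] → ∀ {f} → f ∈ E → Incident f v → f ∈ A
    started   : ∀ {b} → last T ≡ just b → Σ Edge λ e → IsMinIncident E v e × rk e ≡ b

spineStart-initial : ∀ v E → SpineStart v E [] (sortE E)
spineStart-initial v E = record
  { unstarted = λ _ f∈E _ → ∈-resp-↭ (↭-sym (sortE-↭ E)) f∈E
  ; started   = λ () }

spineStart-step : ∀ {v E T e A} L → SpineStart v E T (e ∷ A) → e ∈ E → Ascending (suc (rk e)) A →
                  L v ≡ head T → SpineStart v E (pushIf (merged? L e v) (rk e) T) A
spineStart-step {v} {T = _ ∷ _} {e} L start _ _ _ with merged? L e v
... | yes _ = record { unstarted = λ () ; started = SpineStart.started start }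
... | no _  = record { unstarted = λ () ; started = SpineStart.started start }
spineStart-step {v} {E} {[]} {e} {A} L start e∈E ascending Lv≡∅ with merged? L e v
... | yes m = record { unstarted = λ () ; started = λ { refl → e , (e∈E , incident , minimal) , refl } }
  where
    incident = merged-singleton-incident Lv≡∅ m
    minimal : ∀ f → f ∈ E → Incident f v → rk e ≤ rk f
    minimal f f∈E f∼v with SpineStart.unstarted start refl f∈E f∼v
    ... | here refl = ≤-refl
    ... | there f∈A = <⇒≤ (ascending-≤ ascending f∈A)
... | no ¬m = record { unstarted = unstarted ; started = λ () }
  where
    unstarted : [] ≡ [] → ∀ {f} → f ∈ E → Incident f v → f ∈ A
    unstarted _ f∈E f∼v with SpineStart.unstarted start refl f∈E f∼v
    ... | here refl = contradiction (incident-merged f∼v) ¬m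
    ... | there f∈A = f∈A

anc-snoc : ∀ {P a b c} → Anc P a b → P b ≡ just c → Anc P a c
anc-snoc here             Pb≡c = there Pb≡c here
anc-snoc (there Pa≡g g⇝b) Pb≡c = there Pa≡g (anc-snoc g⇝b Pb≡c)

chain-anc : ∀ {P T b x} → Chain P T → last T ≡ just b → x ∈ T → Anc P b x
chain-anc {T = _ ∷ []}    [-]            refl   (here refl) = here
chain-anc {T = _ ∷ _ ∷ _} (Ps≡t ∷ chain) last≡b (here refl) = anc-snoc (chain-anc chain last≡b (here refl)) Ps≡t
chain-anc {T = _ ∷ _ ∷ _} (_ ∷ chain)    last≡b (there x∈T) = chain-anc chain last≡b x∈T

chain-parent-∈ : ∀ {P t T y g} → Chain P (t ∷ T) → y ∈ T → P y ≡ just g → g ∈ t ∷ T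
chain-parent-∈ (Ps≡t ∷ _)     (here refl) Py≡g = here (just-injective (trans (sym Py≡g) Ps≡t))
chain-parent-∈ (_    ∷ chain) (there y∈T) Py≡g = there (chain-parent-∈ chain y∈T Py≡g)

chain-closed : ∀ {P t T b x} → Chain P (t ∷ T) → P t ≡ nothing → b ∈ t ∷ T → Anc P b x → x ∈ t ∷ T
chain-closed chain Pt≡∅ b∈T here = b∈T
chain-closed chain Pt≡∅ (here refl) (there Pt≡g _) with trans (sym Pt≡g) Pt≡∅
... | ()
chain-closed chain Pt≡∅ (there b∈T) (there Pb≡g g⇝x) =
  chain-closed chain Pt≡∅ (chain-parent-∈ chain b∈T Pb≡g) g⇝x

chain-next : ∀ {P T x y} → Chain P T → AllPairs _>_ T → x ∈ T → y ∈ T → x < y →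
             (∀ z → z ∈ T → x < z → y ≤ z) → P x ≡ just y
chain-next _ _         (here refl) (here refl) x<y _ = contradiction x<y (<-irrefl refl)
chain-next _ (t>T ∷ _) (here refl) (there y∈T) x<y _ = contradiction x<y (<-asym (All.lookup t>T y∈T))
chain-next {T = t ∷ _ ∷ _} (Px≡t ∷ _) (t>T ∷ s>T ∷ _) (there (here refl)) y∈T x<y least =
  trans Px≡t (cong just (≤-antisym (t≤ y∈T x<y) (least t (here refl) (All.lookup t>T (here refl)))))
  where
    t≤ : ∀ {y} → y ∈ t ∷ _ → _ < y → t ≤ y
    t≤ (here refl)         _   = ≤-refl
    t≤ (there (here refl)) x<y = contradiction x<y (<-irrefl refl)
    t≤ (there (there y∈T)) x<y = contradiction x<y (<-asym (All.lookup s>T y∈T))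
chain-next {T = t ∷ s ∷ _} (_ ∷ chain) (t>T ∷ desc) (there (there x∈T)) y∈T x<y least =
  chain-next chain desc (there x∈T) (not-head y∈T (least s (there (here refl)) x<s)) x<y (λ z → least z ∘ there)
  where
    x<s = All.lookup (AllPairs.head desc) x∈T
    not-head : ∀ {y} → y ∈ t ∷ s ∷ _ → y ≤ s → y ∈ s ∷ _
    not-head (here refl) t≤s = contradiction t≤s (<⇒≱ (All.lookup t>T (here refl)))
    not-head (there y∈T) _   = y∈T

chain-top : ∀ {P : Parents} {T x} → (∀ {t} → head T ≡ just t → P t ≡ nothing) → AllPairs _>_ T → x ∈ T →
            (∀ z → z ∈ T → z ≤ x) → P x ≡ nothing
chain-top root _         (here refl) _        = root refl
chain-top _    (t>T ∷ _) (there x∈T) greatest =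
  contradiction (greatest _ (here refl)) (<⇒≱ (All.lookup t>T x∈T))

-- InSpine E v is, by definition, InSpineOf (foldl step initial (sortE E)) E v.
InSpineOf : State → List Edge → ℕ → ℕ → Set
InSpineOf S E v x = Σ Edge λ e → IsMinIncident E v e × Anc (parents S) (rk e) x

spine-complete : ∀ {v n E S T x} → RunInv v n S T → SpineStart v E T [] → x ∈ T → InSpineOf S E v x
spine-complete {T = t ∷ T} I start x∈T with last-∈ t T
... | b , last≡b , _ with SpineStart.started start last≡b
...   | e , min , refl = e , min , chain-anc (RunInv.chain I) last≡b x∈T

spine-sound : ∀ {v n E S T x} → RunInv v n S T → SpineStart v E T [] → InSpineOf S E v x → x ∈ T
spine-sound {T = []} _ start (e , (e∈E , e∼v , _) , _) with SpineStart.unstarted start refl e∈E e∼v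
... | ()
spine-sound {T = t ∷ T} I start (e , (e∈E , e∼v , e-min) , e⇝x) with last-∈ t T
... | b , last≡b , b∈T with SpineStart.started start last≡b
...   | e* , (e*∈E , e*∼v , e*-min) , refl =
  chain-closed (RunInv.chain I) (RunInv.labels-roots I (RunInv.v-label I)) b∈T
    (subst (λ a → Anc _ a _) (≤-antisym (e-min e* e*∈E e*∼v) (e*-min e e∈E e∼v)) e⇝x)

-- The combined run in lockstep with the runs on E₁ and E₂

record Gluing (v : ℕ) (V₁ V₂ : List ℕ) (E₁ E₂ : List Edge) : Set where
  field
    v∈V₁        : v ∈ V₁
    v∈V₂        : v ∈ V₂
    shared      : ∀ {x} → x ∈ V₁ → x ∈ V₂ → x ≡ v
    ranks-apart : ∀ {k} → k ∈ map rk E₁ → k ∉ map rk E₂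
    ends₁       : ∀ {e} → e ∈ E₁ → u e ∈ V₁ × w e ∈ V₁
    ends₂       : ∀ {e} → e ∈ E₂ → u e ∈ V₂ × w e ∈ V₂

gluing-swap : ∀ {v V₁ V₂ E₁ E₂} → Gluing v V₁ V₂ E₁ E₂ → Gluing v V₂ V₁ E₂ E₁
gluing-swap G = record
  { v∈V₁ = v∈V₂ ; v∈V₂ = v∈V₁ ; shared = λ x∈V₂ x∈V₁ → shared x∈V₁ x∈V₂
  ; ranks-apart = λ k∈E₂ k∈E₁ → ranks-apart k∈E₁ k∈E₂ ; ends₁ = ends₂ ; ends₂ = ends₁ }
  where open Gluing G

-- The combined state S seen on one tree (V, E), whose own run is in state Sᵢ with A still to process.
record Tracks (v : ℕ) (V : List ℕ) (E : List Edge) (n : ℕ)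
              (S : State) (Tc : List ℕ) (Sᵢ : State) (T : List ℕ) (A : List Edge) : Set where
  field
    run           : RunInv v n Sᵢ T
    start         : SpineStart v E T A
    remaining     : All (_∈ E) A
    label-ranks   : ∀ {y k} → labels Sᵢ y ≡ just k → k ∈ map rk E
    absorbed      : ∀ {y} → y ∈ V → cluster (labels Sᵢ) y ≡ cluster (labels Sᵢ) v →
                    cluster (labels S) y ≡ cluster (labels S) v
    kept          : ∀ {y} → y ∈ V → cluster (labels Sᵢ) y ≢ cluster (labels Sᵢ) v →
                    labels S y ≡ labels Sᵢ y
    parents-agree : ∀ {z} → z ∈ map rk E → z ∉ Tc → parents S z ≡ parents Sᵢ z

record Lockstep (v : ℕ) (V₁ V₂ : List ℕ) (E₁ E₂ : List Edge) (n : ℕ) (S : State) (Tc : List ℕ)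
                (S₁ : State) (T₁ : List ℕ) (A : List Edge)
                (S₂ : State) (T₂ : List ℕ) (B : List Edge) : Set where
  field
    combined : RunInv v n S Tc
    side₁    : Tracks v V₁ E₁ n S Tc S₁ T₁ A
    side₂    : Tracks v V₂ E₂ n S Tc S₂ T₂ B
    spines   : Interleaving T₁ T₂ Tc

lockstep-swap : Lockstep v V₁ V₂ E₁ E₂ n S Tc S₁ T₁ A S₂ T₂ B → Lockstep v V₂ V₁ E₂ E₁ n S Tc S₂ T₂ B S₁ T₁ A
lockstep-swap I = record
  { combined = combined ; side₁ = side₂ ; side₂ = side₁ ; spines = Interleaving.swap spines }
  where open Lockstep I

tracks-initial : ∀ v V E → Tracks v V E 0 initial [] initial [] (sortE E)
tracks-initial v V E = record
  { run           = runInv-initial v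
  ; start         = spineStart-initial v E
  ; remaining     = All-resp-↭ (↭-sym (sortE-↭ E)) (All.tabulate (λ e∈E → e∈E))
  ; label-ranks   = λ ()
  ; absorbed      = λ _ y∼v → y∼v
  ; kept          = λ _ _ → refl
  ; parents-agree = λ _ _ → refl }

lockstep-initial : ∀ v V₁ V₂ E₁ E₂ →
                   Lockstep v V₁ V₂ E₁ E₂ 0 initial [] initial [] (sortE E₁) initial [] (sortE E₂)
lockstep-initial v V₁ V₂ E₁ E₂ = record
  { combined = runInv-initial v
  ; side₁    = tracks-initial v V₁ E₁
  ; side₂    = tracks-initial v V₂ E₂
  ; spines   = [] }

v-label-cases : Lockstep v V₁ V₂ E₁ E₂ n S Tc S₁ T₁ A S₂ T₂ B →
                labels S v ≡ labels S₁ v ⊎ labels S v ≡ labels S₂ v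
v-label-cases {v = v} {n = n} {S = S} {Tc = Tc} I =
  Sum.map (via (Tracks.run side₁)) (via (Tracks.run side₂)) (interleaving-head spines)
  where
    open Lockstep I
    via : ∀ {Sᵢ Tᵢ} → RunInv v n Sᵢ Tᵢ → head Tc ≡ head Tᵢ → labels S v ≡ labels Sᵢ v
    via run h = trans (RunInv.v-label combined) (trans h (sym (RunInv.v-label run)))

cross-cluster : Gluing v V₁ V₂ E₁ E₂ → Lockstep v V₁ V₂ E₁ E₂ n S Tc S₁ T₁ A S₂ T₂ B →
                ∀ {x y} → cluster (labels S₁) x ≡ cluster (labels S₂) y → x ≡ y
cross-cluster {S₁ = S₁} G I {x} eq with labels S₁ x in L₁x
... | nothing = sym (cluster-singleton (trans (sym eq) (unlabelled⇒cluster L₁x)))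
... | just _  =
  contradiction (Tracks.label-ranks (Lockstep.side₂ I) (cluster-label (trans (sym eq) (label⇒cluster L₁x))))
                (Gluing.ranks-apart G (Tracks.label-ranks (Lockstep.side₁ I) L₁x))

v-cluster-apart : Gluing v V₁ V₂ E₁ E₂ → Lockstep v V₁ V₂ E₁ E₂ n S Tc S₁ T₁ A S₂ T₂ B →
                  ∀ {y} → y ∈ V₁ → cluster (labels S₁) y ≢ cluster (labels S₁) v →
                  cluster (labels S) v ≢ cluster (labels S₁) y
v-cluster-apart {v = v} G I {y} y∈V₁ y≁₁v v∼y with v-label-cases I
... | inj₁ Lv≡L₁v = y≁₁v (sym (trans (sym (cluster-≡ Lv≡L₁v)) v∼y))
... | inj₂ Lv≡L₂v with cross-cluster G I {y} {v} (sym (trans (sym (cluster-≡ Lv≡L₂v)) v∼y))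
...   | refl = y≁₁v refl

absorbed-or-kept : ∀ {V E Tᵢ} {Sᵢ : State} → Tracks v V E n S Tc Sᵢ Tᵢ A → ∀ {x} → x ∈ V →
  (cluster (labels Sᵢ) x ≡ cluster (labels Sᵢ) v × cluster (labels S) x ≡ cluster (labels S) v) ⊎
  (cluster (labels Sᵢ) x ≢ cluster (labels Sᵢ) v × cluster (labels S) x ≡ cluster (labels Sᵢ) x)
absorbed-or-kept {v = v} {Sᵢ = Sᵢ} side {x} x∈V with ≡-dec _≟_ _≟_ (cluster (labels Sᵢ) x) (cluster (labels Sᵢ) v)
... | yes x∼v = inj₁ (x∼v , Tracks.absorbed side x∈V x∼v)
... | no  x≁v = inj₂ (x≁v , cluster-≡ (Tracks.kept side x∈V x≁v))

same-cluster⇔ : Gluing v V₁ V₂ E₁ E₂ → Lockstep v V₁ V₂ E₁ E₂ n S Tc S₁ T₁ A S₂ T₂ B →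
                ∀ {x y} → x ∈ V₁ → y ∈ V₁ →
                cluster (labels S) x ≡ cluster (labels S) y ⇔ cluster (labels S₁) x ≡ cluster (labels S₁) y
same-cluster⇔ G I x∈V₁ y∈V₁
  with absorbed-or-kept (Lockstep.side₁ I) x∈V₁ | absorbed-or-kept (Lockstep.side₁ I) y∈V₁
... | inj₁ (x∼₁v , x∼v) | inj₁ (y∼₁v , y∼v) =
  mk⇔ (λ _ → trans x∼₁v (sym y∼₁v)) (λ _ → trans x∼v (sym y∼v))
... | inj₂ (_ , x≡₁x) | inj₂ (_ , y≡₁y) =
  mk⇔ (λ eq → trans (sym x≡₁x) (trans eq y≡₁y)) (λ eq → trans x≡₁x (trans eq (sym y≡₁y)))
... | inj₁ (x∼₁v , x∼v) | inj₂ (y≁₁v , y≡₁y) =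
  mk⇔ (λ eq → contradiction (trans (sym x∼v) (trans eq y≡₁y)) (v-cluster-apart G I y∈V₁ y≁₁v))
      (λ eq → contradiction (trans (sym eq) x∼₁v) y≁₁v)
... | inj₂ (x≁₁v , x≡₁x) | inj₁ (y∼₁v , y∼v) =
  mk⇔ (λ eq → contradiction (trans (sym y∼v) (trans (sym eq) x≡₁x)) (v-cluster-apart G I x∈V₁ x≁₁v))
      (λ eq → contradiction (trans eq y∼₁v) x≁₁v)

merged⇔ : Gluing v V₁ V₂ E₁ E₂ → Lockstep v V₁ V₂ E₁ E₂ n S Tc S₁ T₁ A S₂ T₂ B →
          ∀ {e y} → e ∈ E₁ → y ∈ V₁ → Merged (labels S) e y ⇔ Merged (labels S₁) e y
merged⇔ G I e∈E₁ y∈V₁ = mk⇔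
  (λ { (viaᵘ m) → viaᵘ (to (same-cluster⇔ G I uᵉ y∈V₁) m)
     ; (viaʷ m) → viaʷ (to (same-cluster⇔ G I wᵉ y∈V₁) m) })
  (λ { (viaᵘ m) → viaᵘ (from (same-cluster⇔ G I uᵉ y∈V₁) m)
     ; (viaʷ m) → viaʷ (from (same-cluster⇔ G I wᵉ y∈V₁) m) })
  where
    uᵉ = proj₁ (Gluing.ends₁ G e∈E₁)
    wᵉ = proj₂ (Gluing.ends₁ G e∈E₁)

label-off-spine⇔ : Lockstep v V₁ V₂ E₁ E₂ n S Tc S₁ T₁ A S₂ T₂ B → ∀ {x z} → x ∈ V₁ → z ∉ Tc →
                   labels S x ≡ just z ⇔ labels S₁ x ≡ just z
label-off-spine⇔ {v = v} {S = S} {S₁ = S₁} I {x} x∈V₁ z∉Tc with absorbed-or-kept (Lockstep.side₁ I) x∈V₁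
... | inj₂ (_ , x≡₁x) = mk⇔ (trans (sym (cluster-injective x≡₁x))) (trans (cluster-injective x≡₁x))
... | inj₁ (x∼₁v , x∼v) = mk⇔
  (λ Lx≡z → contradiction (v-label-∈ (Lockstep.combined I) (v-labelled (labels S) x∼v Lx≡z)) z∉Tc)
  (λ L₁x≡z → contradiction (∈-interleavingˡ (Lockstep.spines I)
                              (v-label-∈ (Tracks.run (Lockstep.side₁ I)) (v-labelled (labels S₁) x∼₁v L₁x≡z)))
                           z∉Tc)
  where
    v-labelled : ∀ L {z} → cluster L x ≡ cluster L v → L x ≡ just z → L v ≡ just z
    v-labelled L x∼v Lx≡z = cluster-label (trans (sym x∼v) (label⇒cluster Lx≡z))

kept-cluster-apart : Gluing v V₁ V₂ E₁ E₂ → Lockstep v V₁ V₂ E₁ E₂ n S Tc S₁ T₁ A S₂ T₂ B →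
                     ∀ {x y} → x ∈ V₁ → y ∈ V₂ → cluster (labels S₂) y ≢ cluster (labels S₂) v →
                     cluster (labels S) x ≢ cluster (labels S) y
kept-cluster-apart G I {x} {y} x∈V₁ y∈V₂ y≁₂v x∼y
  with absorbed-or-kept (Lockstep.side₂ I) y∈V₂ | absorbed-or-kept (Lockstep.side₁ I) x∈V₁
... | inj₁ (y∼₂v , _) | _ = y≁₂v y∼₂v
... | inj₂ (_ , y≡₂y) | inj₁ (_ , x∼v) =
  v-cluster-apart (gluing-swap G) (lockstep-swap I) y∈V₂ y≁₂v (trans (sym x∼v) (trans x∼y y≡₂y))
... | inj₂ (_ , y≡₂y) | inj₂ (x≁₁v , x≡₁x) with cross-cluster G I {x} {y} (trans (sym x≡₁x) (trans x∼y y≡₂y))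
...   | refl with Gluing.shared G x∈V₁ y∈V₂
...     | refl = x≁₁v refl

unmerged-across : Gluing v V₁ V₂ E₁ E₂ → Lockstep v V₁ V₂ E₁ E₂ n S Tc S₁ T₁ A S₂ T₂ B →
                  ∀ {e y} → e ∈ E₁ → y ∈ V₂ → cluster (labels S₂) y ≢ cluster (labels S₂) v →
                  ¬ Merged (labels S) e y
unmerged-across G I e∈E₁ y∈V₂ y≁₂v (viaᵘ x∼y) =
  kept-cluster-apart G I (proj₁ (Gluing.ends₁ G e∈E₁)) y∈V₂ y≁₂v x∼y
unmerged-across G I e∈E₁ y∈V₂ y≁₂v (viaʷ x∼y) =
  kept-cluster-apart G I (proj₂ (Gluing.ends₁ G e∈E₁)) y∈V₂ y≁₂v x∼y

module _ (G : Gluing v V₁ V₂ E₁ E₂) {e : Edge} (I : Lockstep v V₁ V₂ E₁ E₂ n S Tc S₁ T₁ (e ∷ A) S₂ T₂ B)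
         (n≤e : n ≤ rk e) where
  private
    open Lockstep I
    module Side₁ = Tracks side₁
    module Side₂ = Tracks side₂
    e∈E₁ = All.head Side₁.remaining
    ends = Gluing.ends₁ G e∈E₁
    L  = labels S
    L₁ = labels S₁
    r  = rk e

    active-label-ranks : ∀ {y k} → stepLabels L₁ e y ≡ just k → k ∈ map rk E₁
    active-label-ranks {y} eq with merged? L₁ e y
    ... | yes m = subst (_∈ map rk E₁) (just-injective (trans (sym (step-label-merged m)) eq)) (∈-map⁺ rk e∈E₁)
    ... | no ¬m = Side₁.label-ranks (trans (sym (step-label-unmerged ¬m)) eq)

    active-absorbed : ∀ {y} → y ∈ V₁ → cluster (stepLabels L₁ e) y ≡ cluster (stepLabels L₁ e) v →
                      cluster (stepLabels L e) y ≡ cluster (stepLabels L e) v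
    active-absorbed y∈V₁ y∼v with step-same-cluster (λ _ → cluster-fresh Side₁.run n≤e) y∼v
    ... | inj₁ y∼₁v      = step-cluster-resp (Side₁.absorbed y∈V₁ y∼₁v)
    ... | inj₂ (my , mv) = trans (step-cluster-merged (from (merged⇔ G I e∈E₁ y∈V₁) my))
                                 (sym (step-cluster-merged (from (merged⇔ G I e∈E₁ (Gluing.v∈V₁ G)) mv)))

    active-kept : ∀ {y} → y ∈ V₁ → cluster (stepLabels L₁ e) y ≢ cluster (stepLabels L₁ e) v →
                  stepLabels L e y ≡ stepLabels L₁ e y
    active-kept {y} y∈V₁ y≁v with merged? L₁ e y
    ... | yes m = trans (step-label-merged (from (merged⇔ G I e∈E₁ y∈V₁) m)) (sym (step-label-merged m))
    ... | no ¬m = trans (step-label-unmerged (¬m ∘ to (merged⇔ G I e∈E₁ y∈V₁)))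
                        (trans (Side₁.kept y∈V₁ (y≁v ∘ step-cluster-resp)) (sym (step-label-unmerged ¬m)))

    active-parents-agree : ∀ {z} → z ∈ map rk E₁ → z ∉ spineStep v S e Tc →
                           parents (step S e) z ≡ parents (step S₁ e) z
    active-parents-agree z∈E₁ z∉Tc′ = step-parent-cong L (parents S) L₁ (parents S₁) e
      (label-off-spine⇔ I (proj₁ ends) z∉Tc) (label-off-spine⇔ I (proj₂ ends) z∉Tc)
      (Side₁.parents-agree z∈E₁ z∉Tc)
      where z∉Tc = z∉Tc′ ∘ ∈-pushIf (merged? L e v)

    active-step : Ascending (suc r) A →
                  Tracks v V₁ E₁ (suc r) (step S e) (spineStep v S e Tc) (step S₁ e) (spineStep v S₁ e T₁) A
    active-step ascending = record
      { run           = runInv-step Side₁.run e n≤e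
      ; start         = spineStart-step L₁ Side₁.start e∈E₁ ascending (RunInv.v-label Side₁.run)
      ; remaining     = All.tail Side₁.remaining
      ; label-ranks   = active-label-ranks
      ; absorbed      = active-absorbed
      ; kept          = active-kept
      ; parents-agree = active-parents-agree }

    passive-parents-agree : ∀ {z} → z ∈ map rk E₂ → z ∉ spineStep v S e Tc → parents (step S e) z ≡ parents S₂ z
    passive-parents-agree {z} z∈E₂ z∉Tc′ =
      trans (step-parent-miss L (parents S) e (unlabelled (proj₁ ends)) (unlabelled (proj₂ ends)))
            (Side₂.parents-agree z∈E₂ z∉Tc)
      where
        z∉Tc = z∉Tc′ ∘ ∈-pushIf (merged? L e v)
        unlabelled : ∀ {x} → x ∈ V₁ → L x ≢ just z
        unlabelled x∈V₁ Lx≡z =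
          Gluing.ranks-apart G (Side₁.label-ranks (to (label-off-spine⇔ I x∈V₁ z∉Tc) Lx≡z)) z∈E₂

    passive-step : Tracks v V₂ E₂ (suc r) (step S e) (spineStep v S e Tc) S₂ T₂ B
    passive-step = record
      { run           = runInv-weaken (≤-trans n≤e (n≤1+n r)) Side₂.run
      ; start         = Side₂.start
      ; remaining     = Side₂.remaining
      ; label-ranks   = Side₂.label-ranks
      ; absorbed      = λ y∈V₂ y∼v → step-cluster-resp (Side₂.absorbed y∈V₂ y∼v)
      ; kept          = λ y∈V₂ y≁v → trans (step-label-unmerged (unmerged-across G I e∈E₁ y∈V₂ y≁v))
                                           (Side₂.kept y∈V₂ y≁v)
      ; parents-agree = passive-parents-agree }

  lockstep-stepˡ : Ascending (suc r) A →
                   Lockstep v V₁ V₂ E₁ E₂ (suc r) (step S e) (spineStep v S e Tc)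
                            (step S₁ e) (spineStep v S₁ e T₁) A S₂ T₂ B
  lockstep-stepˡ ascending = record
    { combined = runInv-step combined e n≤e
    ; side₁    = active-step ascending
    ; side₂    = passive-step
    ; spines   = interleaving-push (merged? L e v) (merged? L₁ e v) (merged⇔ G I e∈E₁ (Gluing.v∈V₁ G)) spines }

lockstep-stepʳ : Gluing v V₁ V₂ E₁ E₂ → Lockstep v V₁ V₂ E₁ E₂ n S Tc S₁ T₁ A S₂ T₂ (e ∷ B) →
                 n ≤ rk e → Ascending (suc (rk e)) B →
                 Lockstep v V₁ V₂ E₁ E₂ (suc (rk e)) (step S e) (spineStep v S e Tc)
                          S₁ T₁ A (step S₂ e) (spineStep v S₂ e T₂) B
lockstep-stepʳ G I n≤e ascending =
  lockstep-swap (lockstep-stepˡ (gluing-swap G) (lockstep-swap I) n≤e ascending)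

lockstep-run : Gluing v V₁ V₂ E₁ E₂ → Interleaving A B l → Ascending n l →
               Lockstep v V₁ V₂ E₁ E₂ n S Tc S₁ T₁ A S₂ T₂ B →
               Σ ℕ λ n′ → Σ (List ℕ) λ Tc′ → Σ (List ℕ) λ T₁′ → Σ (List ℕ) λ T₂′ →
               Lockstep v V₁ V₂ E₁ E₂ n′ (foldl step S l) Tc′ (foldl step S₁ A) T₁′ [] (foldl step S₂ B) T₂′ []
lockstep-run G []         []                I = _ , _ , _ , _ , I
lockstep-run G (consˡ il) (n≤e ∷ ascending) I =
  lockstep-run G il ascending (lockstep-stepˡ G I n≤e (interleaving-ascendingˡ il ascending))
lockstep-run G (consʳ il) (n≤e ∷ ascending) I =
  lockstep-run G il ascending (lockstep-stepʳ G I n≤e (interleaving-ascendingʳ il ascending))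

lockstep-spine⇔ : Lockstep v V₁ V₂ E₁ E₂ n S Tc S₁ T₁ [] S₂ T₂ [] →
                  ∀ {x} → x ∈ Tc ⇔ (InSpineOf S₁ E₁ v x ⊎ InSpineOf S₂ E₂ v x)
lockstep-spine⇔ I = mk⇔
  (λ x∈Tc → Sum.map (spine-complete Side₁.run Side₁.start) (spine-complete Side₂.run Side₂.start)
                    (∈-interleaving⁻ spines x∈Tc))
  (λ { (inj₁ x∈S₁) → ∈-interleavingˡ spines (spine-sound Side₁.run Side₁.start x∈S₁)
     ; (inj₂ x∈S₂) → ∈-interleavingˡ (Interleaving.swap spines) (spine-sound Side₂.run Side₂.start x∈S₂) })
  where
    open Lockstep I
    module Side₁ = Tracks side₁
    module Side₂ = Tracks side₂

lockstep-conclusions : Lockstep v V₁ V₂ E₁ E₂ n S Tc S₁ T₁ [] S₂ T₂ [] →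
  let InS = λ x → InSpineOf S₁ E₁ v x ⊎ InSpineOf S₂ E₂ v x in
  (∀ e → e ∈ E₁ → ¬ InS (rk e) → parents S (rk e) ≡ parents S₁ (rk e))
  × (∀ e → e ∈ E₂ → ¬ InS (rk e) → parents S (rk e) ≡ parents S₂ (rk e))
  × (∀ x y → InS x → InS y → x < y → (∀ z → InS z → x < z → y ≤ z) → parents S x ≡ just y)
  × (∀ x → InS x → (∀ z → InS z → z ≤ x) → parents S x ≡ nothing)
lockstep-conclusions I =
  (λ e e∈E₁ e∉S → Tracks.parents-agree side₁ (∈-map⁺ rk e∈E₁) (e∉S ∘ to spine⇔)) ,
  (λ e e∈E₂ e∉S → Tracks.parents-agree side₂ (∈-map⁺ rk e∈E₂) (e∉S ∘ to spine⇔)) ,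
  (λ x y x∈S y∈S x<y least → chain-next chain descending (from spine⇔ x∈S) (from spine⇔ y∈S) x<y
                                         (λ z z∈Tc → least z (to spine⇔ z∈Tc))) ,
  (λ x x∈S greatest → chain-top (labels-roots ∘ trans v-label) descending (from spine⇔ x∈S)
                                (λ z z∈Tc → greatest z (to spine⇔ z∈Tc)))
  where
    open Lockstep I
    open RunInv combined
    spine⇔ = lockstep-spine⇔ I

theorem3p5 : (V₁ V₂ : List ℕ) (E₁ E₂ : List Edge) (v : ℕ) →
    IsTree V₁ E₁ → IsTree V₂ E₂ →
    v ∈ V₁ → v ∈ V₂ → (∀ x → x ∈ V₁ → x ∈ V₂ → x ≡ v) →
    Unique (map rk (E₁ ++ E₂)) →
    -- edges of E₁ outside S keep their D₁-parent
    (∀ e → e ∈ E₁ → ¬ InS E₁ E₂ v (rk e) → SLD (E₁ ++ E₂) (rk e) ≡ SLD E₁ (rk e))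
    -- edges of E₂ outside S keep their D₂-parent
    × (∀ e → e ∈ E₂ → ¬ InS E₁ E₂ v (rk e) → SLD (E₁ ++ E₂) (rk e) ≡ SLD E₂ (rk e))
    -- an element of S gets the next element of S (in rank order) as parent
    × (∀ x y → InS E₁ E₂ v x → InS E₁ E₂ v y → x < y →
         (∀ z → InS E₁ E₂ v z → x < z → y ≤ z) →
         SLD (E₁ ++ E₂) x ≡ just y)
    -- the maximum-rank element of S is the root
    × (∀ x → InS E₁ E₂ v x → (∀ z → InS E₁ E₂ v z → z ≤ x) →
         SLD (E₁ ++ E₂) x ≡ nothing)
theorem3p5 V₁ V₂ E₁ E₂ v tree₁ tree₂ v∈V₁ v∈V₂ shared uniq =
  let _ , _ , _ , _ , I = lockstep-run gluing (sortE-++-interleaving E₁ E₂ uniq)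
                                       (sortE-ascending (E₁ ++ E₂) uniq) (lockstep-initial v V₁ V₂ E₁ E₂)
  in lockstep-conclusions I
  where
    gluing : Gluing v V₁ V₂ E₁ E₂
    gluing = record
      { v∈V₁        = v∈V₁
      ; v∈V₂        = v∈V₂
      ; shared      = shared _
      ; ranks-apart = unique-++-apart (map rk E₁) (subst Unique (map-++ rk E₁ E₂) uniq)
      ; ends₁       = All.lookup (IsTree.ends-in-V tree₁)
      ; ends₂       = All.lookup (IsTree.ends-in-V tree₂) }
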